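{- Let $H=(V,\Delta)$ be a 3-graph with underlying graph $G$. If $H$ has a spanning tree, then for every non-empty $S\subseteq V$ we have $q(G-S)\le |S|-1$, where $q(G-S)$ denotes the number of connected components of $G-S$ having an odd number of vertices.
   Context: A 3-graph is $H=(V,\Delta)$ with $\Delta\subseteq\binom V3$ (triples). The underlying graph $G$ of $H$ is the multigraph on $V$ with an edge $ab$ for each triple containing $\{a,b\}$ (with multiplicity). $G-S$ is $G$ with the vertices of $S$ and incident edges removed. A cycle in $H$ is a sequence $a_0,t_1,a_1,\dots,t_\ell,a_\ell=a_0$, $\ell\ge2$, of distinct vertices $a_0,\dots,a_{\ell-1}$ and distinct triples with $a_{i-1},a_i\in t_i$. A spanning tree is a set of triples containing no cycle, covering $V$, and connected (any two vertices joined by a path of distinct vertices and distinct triples of $T$, consecutive vertices lying in the triple between them). -}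

module Defs where

open import Data.Nat using (ℕ; zero; suc; _≤_; _∸_; _%_)
open import Data.Fin using (Fin; zero; suc; fromℕ; inject₁)
open import Data.Fin.Subset using (Subset; _∈_; _∉_; ∣_∣; Nonempty)
open import Data.List using (List; length)
open import Data.List.Relation.Unary.All using (All)
open import Data.List.Relation.Unary.Unique.Propositional using (Unique)
open import Data.Product using (Σ; ∃; _×_; _,_)
open import Function.Definitions using (Injective)
open import Relation.Binary.PropositionalEquality using (_≡_; _≢_)
open import Relation.Nullary using (¬_)

-- A 3-graph on vertex set V = Fin n with m triples, given as an injective
-- family (so Δ is a *set* of triples) of 3-element subsets of V.
record ThreeGraph (n m : ℕ) : Set where
  field
    Δ      : Fin m → Subset n
    size3  : ∀ i → ∣ Δ i ∣ ≡ 3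
    distinct : Injective _≡_ _≡_ Δ
open ThreeGraph public

module _ {n m : ℕ} (H : ThreeGraph n m) where

  record PathIn (T : Subset m) (u v : Fin n) : Set where
    field
      k      : ℕ
      a      : Fin (suc k) → Fin n
      t      : Fin k → Fin m
      a-inj  : Injective _≡_ _≡_ a
      t-inj  : Injective _≡_ _≡_ t
      t∈T    : ∀ i → t i ∈ T
      start  : a zero ≡ u
      end    : a (fromℕ k) ≡ v
      left∈  : ∀ i → a (inject₁ i) ∈ Δ H (t i)
      right∈ : ∀ i → a (suc i) ∈ Δ H (t i)

  record CycleIn (T : Subset m) : Set where
    field
      ℓ      : ℕ
      ℓ≥2    : 2 ≤ ℓ
      a      : Fin (suc ℓ) → Fin n
      t      : Fin ℓ → Fin m
      closed : a (fromℕ ℓ) ≡ a zero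
      a-inj  : Injective _≡_ _≡_ (λ i → a (inject₁ i))
      t-inj  : Injective _≡_ _≡_ t
      t∈T    : ∀ i → t i ∈ T
      left∈  : ∀ i → a (inject₁ i) ∈ Δ H (t i)
      right∈ : ∀ i → a (suc i) ∈ Δ H (t i)

  record SpanningTree (T : Subset m) : Set where
    field
      acyclic   : ¬ CycleIn T
      covering  : ∀ (v : Fin n) → ∃ λ i → i ∈ T × v ∈ Δ H i
      connected : ∀ (u v : Fin n) → PathIn T u v

  HasSpanningTree : Set
  HasSpanningTree = Σ (Subset m) SpanningTree

  -- Adjacency in the underlying graph G (multiplicity is irrelevant for
  -- connectivity): distinct a, b lying in a common triple.
  Adj : Fin n → Fin n → Set
  Adj a b = a ≢ b × ∃ λ i → a ∈ Δ H i × b ∈ Δ H i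

  data Reach (S : Subset n) : Fin n → Fin n → Set where
    here : ∀ {a} → a ∉ S → Reach S a a
    step : ∀ {a b c} → a ∉ S → Adj a b → Reach S b c → Reach S a c

  record IsComponent (S C : Subset n) : Set where
    field
      nonempty : Nonempty C
      avoids   : ∀ v → v ∈ C → v ∉ S
      conn     : ∀ u v → u ∈ C → v ∈ C → Reach S u v
      maximal  : ∀ u w → u ∈ C → w ∉ S → Adj u w → w ∈ C

  IsOddComponent : Subset n → Subset n → Set
  IsOddComponent S C = IsComponent S C × ∣ C ∣ % 2 ≡ 1

  -- q(G - S) ≤ k : every family of pairwise distinct odd components of G - S
  -- has at most k members.
  q≤ : Subset n → ℕ → Set
  q≤ S k = ∀ (Cs : List (Subset n)) → Unique Cs →
             All (IsOddComponent S) Cs → length Cs ≤ k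

-- Restricted to the vertices it covers, a spanning tree T has a leaf: a triple
-- {x, y, z} ∈ T such that y and z lie in no other triple of T.  Pruning it leaves a
-- tree on W − {y, z}, so every such tree has an odd number of vertices.  By induction
-- on |T| we prove more: for ∅ ≠ S ⊆ W, at most |S| − 1 pairwise disjoint odd sets are
-- unions of components of (W, T) − S.  Each odd component of G − S is such a union.
-- In the inductive step, if y, z ∉ S we delete y and z from every set; if only y ∈ S,
-- at most one set meets z and the others are unions for S − y (when S = {y}, none
-- exists, by parity); if y, z ∈ S the sets are unions for S − {y, z}, or all contain
-- x when S = {y, z}.
module Submission where

open import Defs
open import Data.Nat using (ℕ; zero; suc; _+_; _∸_; _≤_; _<_; _%_; z≤n; s≤s)
open import Data.Nat.Properties
  using (module ≤-Reasoning; suc-injective; 0≢1+n; ≤-reflexive; ≤-trans; <-≤-trans; ≤-pred; n≤1+n;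
         m≤n⇒m≤1+n; <⇒≤; <⇒≢; m∸n≤m; m≤m+n; +-suc; 1+n≰n; anyUpTo?)
open import Data.Fin using (Fin; zero; suc; toℕ; fromℕ; inject₁)
open import Data.Fin.Properties
  using (toℕ<n; toℕ-fromℕ; toℕ-inject₁; inject₁ℕ<; toℕ-injective; inject₁-injective; injective⇒≤)
  renaming (_≟_ to _≟ᶠ_; any? to anyᶠ?)
open import Data.Fin.Induction using (<-weakInduction)
open import Data.Fin.Subset
  using (Subset; inside; outside; _∈_; _∉_; _⊆_; ∣_∣; Nonempty; Empty; _─_; _-_; _∪_; ⁅_⁆; ⊤)
  renaming (⊥ to ∅)
open import Data.Fin.Subset.Properties
  using (_∈?_; nonempty?; Empty-unique; ∣⊥∣≡0; ∣⁅x⁆∣≡1; ∉⊥; ∈⊤; x∈⁅x⁆; x∈⁅y⁆⇒x≡y; p─⊥≡p; p─q⊆p;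
         x∈p∧x∉q⇒x∈p─q; x∈p∧x≢y⇒x∈p-y; x≢y⇒x∉⁅y⁆; p─x─y≡p─y─x; ⊆-antisym; x∈p∪q⁺; x∈p∪q⁻)
open import Data.Vec.Base using (_∷_; here; there)
open import Data.List using ([]; _∷_; length; filter)
open import Data.List.Properties using (length-map; filter-all)
open import Data.List.Relation.Unary.All as All using (All; []; _∷_)
import Data.List.Relation.Unary.All.Properties as All
open import Data.List.Relation.Unary.AllPairs as AllPairs using (AllPairs; []; _∷_)
import Data.List.Relation.Unary.AllPairs.Properties as AllPairs
open import Data.List.Relation.Unary.Unique.Propositional using (Unique)
open import Data.Product using (Σ; ∃; ∃₂; _×_; _,_; proj₁; proj₂)
open import Data.Sum as Sum using (_⊎_; inj₁; inj₂)
open import Data.Empty using (⊥; ⊥-elim)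
open import Function using (_∘_)
open import Relation.Binary.PropositionalEquality
open import Relation.Nullary using (¬_; Dec; yes; no; ¬?; contradiction)
open import Relation.Nullary.Decidable using (_×-dec_)

private
  variable
    n m k : ℕ
    p q : Subset n

Odd : ℕ → Set
Odd k = k % 2 ≡ 1

Odd⇒¬Odd-suc : Odd k → ¬ Odd (suc k)
Odd⇒¬Odd-suc {suc zero}    _ ()
Odd⇒¬Odd-suc {suc (suc k)} = Odd⇒¬Odd-suc {k}

∣p∣≡1+∣p-x∣ : ∀ {x : Fin n} → x ∈ p → ∣ p ∣ ≡ suc ∣ p - x ∣
∣p∣≡1+∣p-x∣ {p = inside ∷ p}  here        = cong (suc ∘ ∣_∣) (sym (p─⊥≡p p))
∣p∣≡1+∣p-x∣ {p = inside ∷ p}  (there x∈p) = cong suc (∣p∣≡1+∣p-x∣ x∈p)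
∣p∣≡1+∣p-x∣ {p = outside ∷ p} (there x∈p) = ∣p∣≡1+∣p-x∣ x∈p

∣p-x∣≡∣p∣ : ∀ {x : Fin n} → x ∉ p → ∣ p - x ∣ ≡ ∣ p ∣
∣p-x∣≡∣p∣ {p = outside ∷ p} {x = zero} _   = cong ∣_∣ (p─⊥≡p p)
∣p-x∣≡∣p∣ {p = inside ∷ p} {x = zero}  x∉p = contradiction here x∉p
∣p-x∣≡∣p∣ {p = outside ∷ p} {x = suc x} x∉p = ∣p-x∣≡∣p∣ (x∉p ∘ there)
∣p-x∣≡∣p∣ {p = inside ∷ p} {x = suc x}  x∉p = cong suc (∣p-x∣≡∣p∣ (x∉p ∘ there))

∣p∣≡2+∣p-x-y∣ : ∀ {x y : Fin n} → x ∈ p → y ∈ p → x ≢ y → ∣ p ∣ ≡ 2 + ∣ p - x - y ∣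
∣p∣≡2+∣p-x-y∣ x∈p y∈p x≢y =
  trans (∣p∣≡1+∣p-x∣ x∈p) (cong suc (∣p∣≡1+∣p-x∣ (x∈p∧x≢y⇒x∈p-y y∈p (x≢y ∘ sym))))

x∈p─q⇒x∉q : ∀ {x : Fin n} → x ∈ p ─ q → x ∉ q
x∈p─q⇒x∉q {p = _ ∷ _} {inside ∷ _} () here
x∈p─q⇒x∉q {p = _ ∷ _} {_ ∷ _} (there x∈p─q) (there x∈q) = x∈p─q⇒x∉q x∈p─q x∈q

x∈p-y⇒x∈p : ∀ (p : Subset n) {x y} → x ∈ p - y → x ∈ p
x∈p-y⇒x∈p p = p─q⊆p p _

x∈p-y⇒x≢y : ∀ (p : Subset n) {x y} → x ∈ p - y → x ≢ y
x∈p-y⇒x≢y p {x} x∈p-x refl = x∈p─q⇒x∉q {p = p} x∈p-x (x∈⁅x⁆ x)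

x∈p-y-z⁻ : ∀ (p : Subset n) {x y z} → x ∈ p - y - z → x ∈ p × x ≢ y × x ≢ z
x∈p-y-z⁻ p x∈p-y-z = x∈p-y⇒x∈p p x∈p-y , x∈p-y⇒x≢y p x∈p-y , x∈p-y⇒x≢y (p - _) x∈p-y-z
  where x∈p-y = x∈p-y⇒x∈p (p - _) x∈p-y-z

x∈p-y-z⁺ : ∀ {x y z : Fin n} → x ∈ p → x ≢ y → x ≢ z → x ∈ p - y - z
x∈p-y-z⁺ x∈p x≢y x≢z = x∈p∧x≢y⇒x∈p-y (x∈p∧x≢y⇒x∈p-y x∈p x≢y) x≢z

∣p-x-y∣≡∣p∣ : ∀ {x y : Fin n} → x ∉ p → y ∉ p → ∣ p - x - y ∣ ≡ ∣ p ∣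
∣p-x-y∣≡∣p∣ {p = p} x∉p y∉p = trans (∣p-x∣≡∣p∣ (y∉p ∘ x∈p-y⇒x∈p p)) (∣p-x∣≡∣p∣ x∉p)

x∈p⇒∣p∣≢0 : ∀ {x : Fin n} → x ∈ p → ∣ p ∣ ≢ 0
x∈p⇒∣p∣≢0 x∈p ∣p∣≡0 = 0≢1+n (trans (sym ∣p∣≡0) (∣p∣≡1+∣p-x∣ x∈p))

∣p∣≢0⇒Nonempty : ∀ {n} {p : Subset n} → ∣ p ∣ ≢ 0 → Nonempty p
∣p∣≢0⇒Nonempty {n = n} {p = p} ∣p∣≢0 with nonempty? p
... | yes ne = ne
... | no  e  = contradiction (trans (cong ∣_∣ (Empty-unique e)) (∣⊥∣≡0 n)) ∣p∣≢0

Odd∣p∣⇒Nonempty : Odd ∣ p ∣ → Nonempty p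
Odd∣p∣⇒Nonempty odd = ∣p∣≢0⇒Nonempty λ ∣p∣≡0 → 0≢1+n (trans (sym (cong (_% 2) ∣p∣≡0)) odd)

record IsTriple (p : Subset n) (x y z : Fin n) : Set where
  field
    x∈p : x ∈ p
    y∈p : y ∈ p
    z∈p : z ∈ p
    x≢y : x ≢ y
    x≢z : x ≢ z
    y≢z : y ≢ z
    covers : ∀ {u} → u ∈ p → u ≡ x ⊎ u ≡ y ⊎ u ≡ z

  swap : IsTriple p x z y
  swap = record
    { x∈p = x∈p ; y∈p = z∈p ; z∈p = y∈p ; x≢y = x≢z ; x≢z = x≢y ; y≢z = y≢z ∘ sym
    ; covers = Sum.map₂ Sum.swap ∘ covers }

∣p-x∣≡k : ∀ {x : Fin n} → x ∈ p → ∣ p ∣ ≡ suc k → ∣ p - x ∣ ≡ k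
∣p-x∣≡k x∈p ∣p∣≡1+k = suc-injective (trans (sym (∣p∣≡1+∣p-x∣ x∈p)) ∣p∣≡1+k)

pick : ∣ p ∣ ≡ suc k → ∃ λ x → x ∈ p × ∣ p - x ∣ ≡ k
pick ∣p∣≡1+k with x , x∈p ← ∣p∣≢0⇒Nonempty (λ ∣p∣≡0 → 0≢1+n (trans (sym ∣p∣≡0) ∣p∣≡1+k)) =
  x , x∈p , ∣p-x∣≡k x∈p ∣p∣≡1+k

∣p∣≡3⇒IsTriple : ∀ {x : Fin n} → ∣ p ∣ ≡ 3 → x ∈ p → ∃₂ λ y z → IsTriple p x y z
∣p∣≡3⇒IsTriple {p = p} {x = x} ∣p∣≡3 x∈p
  with y , y∈p-x , ∣p-x-y∣≡1 ← pick (∣p-x∣≡k x∈p ∣p∣≡3)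
  with z , z∈p-x-y , ∣p-x-y-z∣≡0 ← pick ∣p-x-y∣≡1 = y , z , record
  { x∈p = x∈p ; y∈p = x∈p-y⇒x∈p p y∈p-x ; z∈p = x∈p-y⇒x∈p p z∈p-x
  ; x≢y = λ x≡y → x∈p-y⇒x≢y p y∈p-x (sym x≡y)
  ; x≢z = λ x≡z → x∈p-y⇒x≢y p z∈p-x (sym x≡z)
  ; y≢z = λ y≡z → x∈p-y⇒x≢y (p - x) z∈p-x-y (sym y≡z) ; covers = covers }
  where
  z∈p-x : z ∈ p - x
  z∈p-x = x∈p-y⇒x∈p (p - x) z∈p-x-y
  covers : ∀ {u} → u ∈ p → u ≡ x ⊎ u ≡ y ⊎ u ≡ z
  covers {u} u∈p with u ≟ᶠ x | u ≟ᶠ y | u ≟ᶠ z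
  ... | yes u≡x | _       | _       = inj₁ u≡x
  ... | no _    | yes u≡y | _       = inj₂ (inj₁ u≡y)
  ... | no _    | no _    | yes u≡z = inj₂ (inj₂ u≡z)
  ... | no u≢x  | no u≢y  | no u≢z  = contradiction ∣p-x-y-z∣≡0
    (x∈p⇒∣p∣≢0 (x∈p∧x≢y⇒x∈p-y (x∈p∧x≢y⇒x∈p-y (x∈p∧x≢y⇒x∈p-y u∈p u≢x) u≢y) u≢z))

Disjoint : Subset n → Subset n → Set
Disjoint p q = ∀ {x} → x ∈ p → x ∉ q

length≤1 : ∀ {x : Fin n} {ps} → AllPairs Disjoint ps → All (x ∈_) ps → length ps ≤ 1
length≤1 []                 []                  = z≤n
length≤1 (_ ∷ [])           (_ ∷ [])            = s≤s z≤n
length≤1 ((p∩q≡∅ ∷ _) ∷ _) (x∈p ∷ x∈q ∷ _)   = contradiction x∈q (p∩q≡∅ x∈p)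

length≤1+filter-∉ : ∀ (x : Fin n) {ps} → AllPairs Disjoint ps →
                    length ps ≤ suc (length (filter (λ p → ¬? (x ∈? p)) ps))
length≤1+filter-∉ x {[]}     []                 = z≤n
length≤1+filter-∉ x {p ∷ ps} (p-disjoint ∷ disjoint) with x ∈? p
... | yes x∈p = ≤-reflexive (cong (suc ∘ length)
                  (sym (filter-all (λ q → ¬? (x ∈? q)) (All.map (λ p∩q≡∅ → p∩q≡∅ x∈p) p-disjoint))))
... | no  _   = s≤s (length≤1+filter-∉ x disjoint)

length≤-uninhabited : ∀ {A : Set} {P : A → Set} {xs} → (∀ {x} → ¬ P x) → All P xs → length xs ≤ k
length≤-uninhabited ¬P []      = z≤n
length≤-uninhabited ¬P (Px ∷ _) = contradiction Px ¬P

InjectiveBelow : ∀ {A : Set} → ℕ → (ℕ → A) → Set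
InjectiveBelow k f = ∀ {i j} → i < k → j < k → f i ≡ f j → i ≡ j

_◂_ : ∀ {A : Set} → A → (ℕ → A) → ℕ → A
(x ◂ f) zero    = x
(x ◂ f) (suc i) = f i

◂-injectiveBelow : ∀ {A : Set} {f : ℕ → A} {x : A} →
  InjectiveBelow k f → (∀ {i} → i < k → f i ≢ x) → InjectiveBelow (suc k) (x ◂ f)
◂-injectiveBelow _ _     {zero}  {zero}  _   _   _    = refl
◂-injectiveBelow _ x-new {zero}  {suc j} _   j<k x≡fj = contradiction (sym x≡fj) (x-new (≤-pred j<k))
◂-injectiveBelow _ x-new {suc i} {zero}  i<k _   fi≡x = contradiction fi≡x (x-new (≤-pred i<k))
◂-injectiveBelow f-inj _ {suc i} {suc j} i<k j<k e    = cong suc (f-inj (≤-pred i<k) (≤-pred j<k) e)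

-- Paths are indexed by ℕ and grow at index 0, so that extending a path and closing
-- an initial segment into a cycle are both done by consing.
module Paths {n m : ℕ} (H : ThreeGraph n m) (T : Subset m) where

  record Path (k : ℕ) : Set where
    field
      a      : ℕ → Fin n
      tr     : ℕ → Fin m
      a-inj  : InjectiveBelow (suc k) a
      tr-inj : InjectiveBelow k tr
      tr∈T   : ∀ {i} → i < k → tr i ∈ T
      left∈  : ∀ {i} → i < k → a i ∈ Δ H (tr i)
      right∈ : ∀ {i} → i < k → a (suc i) ∈ Δ H (tr i)
  open Path

  length<n : Path k → k < n
  length<n {k} P = injective⇒≤ {f = a P ∘ toℕ} λ e → toℕ-injective (a-inj P (toℕ<n _) (toℕ<n _) e)

  extend : ∀ {t w} (P : Path k) → t ∈ T → a P 0 ∈ Δ H t → w ∈ Δ H t →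
           (∀ {i} → i < suc k → a P i ≢ w) → (∀ {i} → i < k → tr P i ≢ t) → Path (suc k)
  extend {t = t} {w} P t∈T a₀∈t w∈t w-new t-new = record
    { a      = w ◂ a P
    ; tr     = t ◂ tr P
    ; a-inj  = ◂-injectiveBelow (a-inj P) w-new
    ; tr-inj = ◂-injectiveBelow (tr-inj P) t-new
    ; tr∈T   = λ { {zero} _ → t∈T   ; {suc i} i<k → tr∈T P (≤-pred i<k) }
    ; left∈  = λ { {zero} _ → w∈t   ; {suc i} i<k → left∈ P (≤-pred i<k) }
    ; right∈ = λ { {zero} _ → a₀∈t  ; {suc i} i<k → right∈ P (≤-pred i<k) } }

  -- The cycle a(j+1), t, a 0, tr 0, a 1, …, tr j, a(j+1).
  close : ∀ {k j t} (P : Path k) → j < k → t ∈ T → a P 0 ∈ Δ H t → a P (suc j) ∈ Δ H t →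
          (∀ {i} → i < suc j → tr P i ≢ t) → CycleIn H T
  close {k} {j} {t} P j<k t∈T a₀∈t a₁₊ⱼ∈t t-new = record
    { ℓ      = suc (suc j)
    ; ℓ≥2    = s≤s (s≤s z≤n)
    ; a      = c
    ; t      = b
    ; closed = cong (a P) (toℕ-fromℕ (suc j))
    ; a-inj  = c-inj
    ; t-inj  = b-inj
    ; t∈T    = λ { zero → t∈T ; (suc f) → tr∈T P (below f) }
    ; left∈  = λ { zero → a₁₊ⱼ∈t
                 ; (suc f) → subst (λ i → a P i ∈ Δ H (b (suc f))) (sym (toℕ-inject₁ f))
                                   (left∈ P (below f)) }
    ; right∈ = λ { zero → a₀∈t ; (suc f) → right∈ P (below f) } }
    where
    c : Fin (suc (suc (suc j))) → Fin n
    c zero    = a P (suc j)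
    c (suc f) = a P (toℕ f)
    b : Fin (suc (suc j)) → Fin m
    b zero    = t
    b (suc f) = tr P (toℕ f)
    below : (f : Fin (suc j)) → toℕ f < k
    below f = <-≤-trans (toℕ<n f) j<k
    inner : (f : Fin (suc j)) → toℕ (inject₁ f) < suc k
    inner f = <-≤-trans (inject₁ℕ< f) (m≤n⇒m≤1+n j<k)
    c-inj : ∀ {f g} → c (inject₁ f) ≡ c (inject₁ g) → f ≡ g
    c-inj {zero}  {zero}  _ = refl
    c-inj {zero}  {suc g} e = contradiction (sym (a-inj P (s≤s j<k) (inner g) e)) (<⇒≢ (inject₁ℕ< g))
    c-inj {suc f} {zero}  e = contradiction (a-inj P (inner f) (s≤s j<k) e) (<⇒≢ (inject₁ℕ< f))
    c-inj {suc f} {suc g} e = cong suc (inject₁-injective (toℕ-injective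
      (a-inj P (inner f) (inner g) e)))
    b-inj : ∀ {f g} → b f ≡ b g → f ≡ g
    b-inj {zero}  {zero}  _ = refl
    b-inj {zero}  {suc g} e = contradiction (sym e) (t-new (toℕ<n g))
    b-inj {suc f} {zero}  e = contradiction e (t-new (toℕ<n f))
    b-inj {suc f} {suc g} e = cong suc (toℕ-injective (tr-inj P (below f) (below g) e))

  Pendant : Fin m → Fin n → Set
  Pendant t x = ∀ {u i} → u ∈ Δ H t → u ≢ x → i ∈ T → u ∈ Δ H i → i ≡ t

  PendantTriple : Set
  PendantTriple = ∃₂ λ t x → t ∈ T × x ∈ Δ H t × Pendant t x

  off-path : ∀ {k u} (P : Path k) → u ≢ a P 0 → ¬ (∃ λ j → j < k × a P (suc j) ≡ u) →
             ∀ {f} → f < suc k → a P f ≢ u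
  off-path _ u≢a₀ _     {zero}  _     a₀≡u = u≢a₀ (sym a₀≡u)
  off-path _ _    u-old {suc f} f<1+k a≡u  = u-old (f , ≤-pred f<1+k , a≡u)

  -- Either u, i would close a cycle, or the path can be extended through t to u,
  -- with i as the next triple.
  advance : ∀ {k t u i} (P : Path k) → t ∈ T → a P 0 ∈ Δ H t → (∀ {j} → j < k → tr P j ≢ t) →
            u ∈ Δ H t → u ≢ a P 0 → i ∈ T → u ∈ Δ H i → i ≢ t → ¬ CycleIn H T →
            Σ (Path (suc k)) λ P′ → a P′ 0 ∈ Δ H i × (∀ {j} → j < suc k → tr P′ j ≢ i)
  advance {k} {t} {u} {i} P t∈T a₀∈t t-new u∈t u≢a₀ i∈T u∈i i≢t acyclic
    with anyUpTo? (λ j → a P (suc j) ≟ᶠ u) k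
  ... | yes (j , j<k , a≡u) = contradiction
    (close P j<k t∈T a₀∈t (subst (_∈ Δ H t) (sym a≡u) u∈t) (λ f<1+j → t-new (<-≤-trans f<1+j j<k)))
    acyclic
  ... | no u-old = enter-i
    where
    P′ : Path (suc k)
    P′ = extend P t∈T a₀∈t u∈t (off-path P u≢a₀ u-old) t-new
    enter-i : Σ (Path (suc k)) λ P′ → a P′ 0 ∈ Δ H i × (∀ {j} → j < suc k → tr P′ j ≢ i)
    enter-i with anyUpTo? (λ j → tr P j ≟ᶠ i) k
    ... | yes (j , j<k , tr≡i) = contradiction
      (close P′ (m≤n⇒m≤1+n j<k) i∈T u∈i (subst (λ s → a P j ∈ Δ H s) tr≡i (left∈ P j<k)) i-new)
      acyclic
      where
      i-new : ∀ {f} → f < suc j → tr P′ f ≢ i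
      i-new {zero}  _   t≡i   = i≢t (sym t≡i)
      i-new {suc f} f<j tr≡i′ =
        <⇒≢ (≤-pred f<j) (tr-inj P (<-≤-trans (≤-pred f<j) (<⇒≤ j<k)) j<k (trans tr≡i′ (sym tr≡i)))
    ... | no i-old = P′ , u∈i , i-new
      where
      i-new : ∀ {f} → f < suc k → tr P′ f ≢ i
      i-new {zero}  _     t≡i  = i≢t (sym t≡i)
      i-new {suc f} f<1+k tr≡i = i-old (f , ≤-pred f<1+k , tr≡i)

  -- Acyclicity lets the walk go on as long as it leaves its current triple t at a
  -- vertex lying in another triple; since it never revisits a vertex, it gets stuck.
  walk : ∀ fuel {k t} (P : Path k) → n ≤ fuel + k → t ∈ T → a P 0 ∈ Δ H t →
         (∀ {j} → j < k → tr P j ≢ t) → ¬ CycleIn H T → PendantTriple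
  walk zero P n≤k _ _ _ _ = contradiction (≤-trans (length<n P) n≤k) 1+n≰n
  walk (suc fuel) {k} {t} P n≤ t∈T a₀∈t t-new acyclic
    with anyᶠ? (λ u → anyᶠ? (λ i →
           (u ∈? Δ H t) ×-dec ¬? (u ≟ᶠ a P 0) ×-dec (i ∈? T) ×-dec (u ∈? Δ H i) ×-dec ¬? (i ≟ᶠ t)))
  ... | no stuck = t , a P 0 , t∈T , a₀∈t , pendant
    where
    pendant : Pendant t (a P 0)
    pendant {u} {i} u∈t u≢a₀ i∈T u∈i with i ≟ᶠ t
    ... | yes i≡t = i≡t
    ... | no  i≢t = contradiction (u , i , u∈t , u≢a₀ , i∈T , u∈i , i≢t) stuck
  ... | yes (u , i , u∈t , u≢a₀ , i∈T , u∈i , i≢t)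
    with P′ , u∈i′ , i-new ← advance P t∈T a₀∈t t-new u∈t u≢a₀ i∈T u∈i i≢t acyclic =
    walk fuel P′ (subst (n ≤_) (sym (+-suc fuel k)) n≤) i∈T u∈i′ i-new acyclic

  pendant-exists : ¬ CycleIn H T → Nonempty T → PendantTriple
  pendant-exists acyclic (t , t∈T) with x , x∈t , _ ← pick {p = Δ H t} (size3 H t) =
    walk n P₀ (m≤m+n n 0) t∈T x∈t (λ ()) acyclic
    where
    P₀ : Path 0
    P₀ = record
      { a = λ _ → x ; tr = λ _ → t ; a-inj = λ { (s≤s z≤n) (s≤s z≤n) _ → refl }
      ; tr-inj = λ () ; tr∈T = λ () ; left∈ = λ () ; right∈ = λ () }

record Leaf (H : ThreeGraph n m) (T : Subset m) : Set where
  field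
    t      : Fin m
    t∈T    : t ∈ T
    x y z  : Fin n
    triple : IsTriple (Δ H t) x y z
    y-only : ∀ {i} → i ∈ T → y ∈ Δ H i → i ≡ t
    z-only : ∀ {i} → i ∈ T → z ∈ Δ H i → i ≡ t

  swap : Leaf H T
  swap = record { t∈T = t∈T ; triple = IsTriple.swap triple ; y-only = z-only ; z-only = y-only }

leaf-exists : ∀ {H : ThreeGraph n m} {T} → ¬ CycleIn H T → Nonempty T → Leaf H T
leaf-exists {H = H} {T} acyclic T≢∅
  with t , x , t∈T , x∈t , pendant ← Paths.pendant-exists H T acyclic T≢∅
  with y , z , triple ← ∣p∣≡3⇒IsTriple (size3 H t) x∈t = record
    { t∈T = t∈T ; triple = triple
    ; y-only = pendant (IsTriple.y∈p triple) (IsTriple.x≢y triple ∘ sym)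
    ; z-only = pendant (IsTriple.z∈p triple) (IsTriple.x≢z triple ∘ sym) }

module OddPieces {n m : ℕ} (H : ThreeGraph n m) where

  ClosedAlong : Fin m → Subset n → Subset n → Set
  ClosedAlong i S C = ∀ {u w} → u ∈ Δ H i → w ∈ Δ H i → u ∉ S → w ∉ S → u ∈ C → w ∈ C

  Closed : Subset m → Subset n → Subset n → Set
  Closed T S C = ∀ {i} → i ∈ T → ClosedAlong i S C

  Connects : Subset m → Subset n → Set
  Connects T W = ∀ {C} → C ⊆ W → Closed T ∅ C → Empty C ⊎ W ⊆ C

  record TreeOn (T : Subset m) (W : Subset n) : Set where
    field
      acyclic  : ¬ CycleIn H T
      spans⊆   : ∀ {i} → i ∈ T → Δ H i ⊆ W
      nonempty : Nonempty W
      connects : Connects T W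

  -- An odd union of components of (W, T) − S; the odd components of G − S are odd
  -- pieces in V for every T.
  record OddPiece (T : Subset m) (S W C : Subset n) : Set where
    field
      odd    : Odd ∣ C ∣
      ⊆W     : C ⊆ W
      avoids : Disjoint C S
      closed : Closed T S C

  FewOddPieces : Subset m → Subset n → Subset n → Set
  FewOddPieces T S W = ∀ {Cs} → AllPairs Disjoint Cs → All (OddPiece T S W) Cs → length Cs ≤ ∣ S ∣ ∸ 1

  OddPieceBound : Subset m → Subset n → Set
  OddPieceBound T W = ∀ {S} → Nonempty S → S ⊆ W → FewOddPieces T S W

  closed-─ : ∀ {T S C R} → Closed T S C → (∀ {i u} → i ∈ T → u ∈ Δ H i → u ∉ R) → Closed T S (C ─ R)
  closed-─ {C = C} {R} closed misses i∈T u∈i w∈i u∉S w∉S u∈C─R =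
    x∈p∧x∉q⇒x∈p─q (closed i∈T u∈i w∈i u∉S w∉S (p─q⊆p C R u∈C─R)) (misses i∈T w∈i)

  closed-insert : ∀ {T S C t} → ClosedAlong t S C → Closed (T - t) S C → Closed T S C
  closed-insert {t = t} along-t closed {i} i∈T with i ≟ᶠ t
  ... | yes refl = along-t
  ... | no  i≢t  = closed (x∈p∧x≢y⇒x∈p-y i∈T i≢t)

  acyclic-⊆ : ∀ {T T′} → T′ ⊆ T → ¬ CycleIn H T → ¬ CycleIn H T′
  acyclic-⊆ T′⊆T acyclic cycle = acyclic record
    { ℓ = ℓ ; ℓ≥2 = ℓ≥2 ; a = a ; t = t ; closed = closed ; a-inj = a-inj ; t-inj = t-inj
    ; t∈T = T′⊆T ∘ t∈T ; left∈ = left∈ ; right∈ = right∈ }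
    where open CycleIn cycle

  no-triples : ∀ {T W} → (∀ {i} → i ∉ T) → TreeOn T W → Odd ∣ W ∣ × OddPieceBound T W
  no-triples {T} {W} no-i tree with w , w∈W ← TreeOn.nonempty tree
    with TreeOn.connects tree {⁅ w ⁆} (λ v∈⁅w⁆ → subst (_∈ W) (sym (x∈⁅y⁆⇒x≡y w v∈⁅w⁆)) w∈W)
                                      (λ i∈T → contradiction i∈T no-i)
  ... | inj₁ ⁅w⁆≡∅  = contradiction (w , x∈⁅x⁆ w) ⁅w⁆≡∅
  ... | inj₂ W⊆⁅w⁆ = subst Odd (sym (trans (cong ∣_∣ W≡⁅w⁆) (∣⁅x⁆∣≡1 w))) refl , bound
    where
    W≡⁅w⁆ : W ≡ ⁅ w ⁆
    W≡⁅w⁆ = ⊆-antisym W⊆⁅w⁆ (λ v∈⁅w⁆ → subst (_∈ W) (sym (x∈⁅y⁆⇒x≡y w v∈⁅w⁆)) w∈W)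
    bound : OddPieceBound T W
    bound (s , s∈S) S⊆W _ = length≤-uninhabited λ piece →
      let open OddPiece piece
          c , c∈C = Odd∣p∣⇒Nonempty odd
          s≡c = trans (x∈⁅y⁆⇒x≡y w (W⊆⁅w⁆ (S⊆W s∈S))) (sym (x∈⁅y⁆⇒x≡y w (W⊆⁅w⁆ (⊆W c∈C))))
      in avoids c∈C (subst (_∈ _) s≡c s∈S)

  module Prune {T W} (tree : TreeOn T W) (leaf : Leaf H T) where

    open TreeOn tree
    open Leaf leaf
    open IsTriple triple

    T′ : Subset m
    T′ = T - t

    W′ : Subset n
    W′ = W - y - z

    T′⊆T : T′ ⊆ T
    T′⊆T = x∈p-y⇒x∈p T

    T′-avoids-y : ∀ {i u} → i ∈ T′ → u ∈ Δ H i → u ≢ y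
    T′-avoids-y i∈T′ u∈i refl = x∈p-y⇒x≢y T i∈T′ (y-only (T′⊆T i∈T′) u∈i)

    T′-avoids-z : ∀ {i u} → i ∈ T′ → u ∈ Δ H i → u ≢ z
    T′-avoids-z i∈T′ u∈i refl = x∈p-y⇒x≢y T i∈T′ (z-only (T′⊆T i∈T′) u∈i)

    only-x : ∀ {u} → u ∈ Δ H t → u ≢ y → u ≢ z → u ≡ x
    only-x u∈t u≢y u≢z with covers u∈t
    ... | inj₁ u≡x        = u≡x
    ... | inj₂ (inj₁ u≡y) = contradiction u≡y u≢y
    ... | inj₂ (inj₂ u≡z) = contradiction u≡z u≢z

    x∈W : x ∈ W
    x∈W = spans⊆ t∈T x∈p

    ∣W∣≡2+∣W′∣ : ∣ W ∣ ≡ 2 + ∣ W′ ∣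
    ∣W∣≡2+∣W′∣ = ∣p∣≡2+∣p-x-y∣ (spans⊆ t∈T y∈p) (spans⊆ t∈T z∈p) y≢z

    restrict-closed : ∀ {S S′ C} → (∀ {u} → u ∉ S′ → u ≢ y → u ≢ z → u ∉ S) →
                      Closed T S C → Closed T′ S′ C
    restrict-closed S⊆S′ closed i∈T′ u∈i w∈i u∉S′ w∉S′ = closed (T′⊆T i∈T′) u∈i w∈i
      (S⊆S′ u∉S′ (T′-avoids-y i∈T′ u∈i) (T′-avoids-z i∈T′ u∈i))
      (S⊆S′ w∉S′ (T′-avoids-y i∈T′ w∈i) (T′-avoids-z i∈T′ w∈i))

    -- A T′-closed set through x becomes T-closed once y and z are added.
    connects′ : Connects T′ W′
    connects′ {C} C⊆W′ closed with x ∈? C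
    ... | yes x∈C = inj₂ W′⊆C
      where
      C⁺ : Subset n
      C⁺ = C ∪ Δ H t
      C⁺⊆C : ∀ {v} → v ∈ C⁺ → v ≢ y → v ≢ z → v ∈ C
      C⁺⊆C v∈C⁺ v≢y v≢z with x∈p∪q⁻ C (Δ H t) v∈C⁺
      ... | inj₁ v∈C = v∈C
      ... | inj₂ v∈t = subst (_∈ C) (sym (only-x v∈t v≢y v≢z)) x∈C
      C⁺-closed : Closed T ∅ C⁺
      C⁺-closed = closed-insert (λ _ w∈t _ _ _ → x∈p∪q⁺ (inj₂ w∈t)) λ i∈T′ u∈i w∈i u∉∅ w∉∅ u∈C⁺ →
        x∈p∪q⁺ (inj₁ (closed i∈T′ u∈i w∈i u∉∅ w∉∅
          (C⁺⊆C u∈C⁺ (T′-avoids-y i∈T′ u∈i) (T′-avoids-z i∈T′ u∈i))))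
      C⁺⊆W : C⁺ ⊆ W
      C⁺⊆W v∈C⁺ with x∈p∪q⁻ C (Δ H t) v∈C⁺
      ... | inj₁ v∈C = proj₁ (x∈p-y-z⁻ W (C⊆W′ v∈C))
      ... | inj₂ v∈t = spans⊆ t∈T v∈t
      W′⊆C : W′ ⊆ C
      W′⊆C v∈W′ with connects C⁺⊆W C⁺-closed | x∈p-y-z⁻ W v∈W′
      ... | inj₁ C⁺≡∅  | _                  = contradiction (x , x∈p∪q⁺ (inj₁ x∈C)) C⁺≡∅
      ... | inj₂ W⊆C⁺ | v∈W , v≢y , v≢z = C⁺⊆C (W⊆C⁺ v∈W) v≢y v≢z
    ... | no x∉C with connects (proj₁ ∘ x∈p-y-z⁻ W ∘ C⊆W′) (closed-insert along-t closed)
      where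
      along-t : ClosedAlong t ∅ C
      along-t u∈t _ _ _ u∈C = let _ , u≢y , u≢z = x∈p-y-z⁻ W (C⊆W′ u∈C) in
        contradiction (subst (_∈ C) (only-x u∈t u≢y u≢z) u∈C) x∉C
    ...   | inj₁ C≡∅  = inj₁ C≡∅
    ...   | inj₂ W⊆C = contradiction (W⊆C x∈W) x∉C

    tree′ : TreeOn T′ W′
    tree′ = record
      { acyclic  = acyclic-⊆ T′⊆T acyclic
      ; spans⊆   = λ i∈T′ u∈i →
          x∈p-y-z⁺ (spans⊆ (T′⊆T i∈T′) u∈i) (T′-avoids-y i∈T′ u∈i) (T′-avoids-z i∈T′ u∈i)
      ; nonempty = x , x∈p-y-z⁺ x∈W x≢y x≢z
      ; connects = connects′ }

    T′-misses-y : ∀ {i u} → i ∈ T′ → u ∈ Δ H i → u ∉ ⁅ y ⁆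
    T′-misses-y i∈T′ u∈i = x≢y⇒x∉⁅y⁆ (T′-avoids-y i∈T′ u∈i)

    T′-misses-z : ∀ {i u} → i ∈ T′ → u ∈ Δ H i → u ∉ ⁅ z ⁆
    T′-misses-z i∈T′ u∈i = x≢y⇒x∉⁅y⁆ (T′-avoids-z i∈T′ u∈i)

    -- y and z lie in the same T-component of W − S, so removing them keeps C odd.
    piece-y-z : ∀ {S C} → y ∉ S → z ∉ S → OddPiece T S W C → OddPiece T′ S W′ (C - y - z)
    piece-y-z {S} {C} y∉S z∉S piece = record
      { odd    = odd′
      ; ⊆W     = λ v∈C′ → let v∈C , v≢y , v≢z = x∈p-y-z⁻ C v∈C′ in x∈p-y-z⁺ (⊆W v∈C) v≢y v≢z
      ; avoids = avoids ∘ proj₁ ∘ x∈p-y-z⁻ C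
      ; closed = closed-─ (closed-─ (restrict-closed (λ u∉S _ _ → u∉S) closed) T′-misses-y)
                          T′-misses-z }
      where
      open OddPiece piece
      odd′ : Odd ∣ C - y - z ∣
      odd′ with y ∈? C
      ... | yes y∈C = subst Odd (∣p∣≡2+∣p-x-y∣ y∈C (closed t∈T y∈p z∈p y∉S z∉S y∈C) y≢z) odd
      ... | no  y∉C = subst Odd (sym (∣p-x-y∣≡∣p∣ y∉C (y∉C ∘ closed t∈T z∈p y∈p z∉S y∉S))) odd

    piece-⊆W′ : ∀ {S S′ C} → OddPiece T S W C → y ∉ C → z ∉ C → S′ ⊆ S →
                (∀ {u} → u ∉ S′ → u ≢ y → u ≢ z → u ∉ S) → OddPiece T′ S′ W′ C
    piece-⊆W′ piece y∉C z∉C S′⊆S S⊆S′ = record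
      { odd    = odd
      ; ⊆W     = λ v∈C → x∈p-y-z⁺ (⊆W v∈C) (λ { refl → y∉C v∈C }) (λ { refl → z∉C v∈C })
      ; avoids = λ v∈C → avoids v∈C ∘ S′⊆S
      ; closed = restrict-closed S⊆S′ closed }
      where open OddPiece piece

    -- With S = {y}, a piece C is T′-closed after removing z; by connectivity of W′ it is
    -- then {z}, impossible as x follows z into C, or W′ plus z, which is even.
    no-piece-at-y : Odd ∣ W′ ∣ → ∀ {S C} → y ∈ S → (∀ {u} → u ≢ y → u ∉ S) → ¬ OddPiece T S W C
    no-piece-at-y W′-odd {S} {C} y∈S S⊆⁅y⁆ piece = absurd (connects′ D⊆W′ D-closed)
      where
      open OddPiece piece
      D : Subset n
      D = C - z
      D-closed : Closed T′ ∅ D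
      D-closed = closed-─ (restrict-closed (λ _ u≢y _ → S⊆⁅y⁆ u≢y) closed) T′-misses-z
      D⊆W′ : D ⊆ W′
      D⊆W′ v∈D = let v∈C = x∈p-y⇒x∈p C v∈D in
        x∈p-y-z⁺ (⊆W v∈C) (λ { refl → avoids v∈C y∈S }) (x∈p-y⇒x≢y C v∈D)
      z∈C⇒x∈C : z ∈ C → x ∈ C
      z∈C⇒x∈C = closed t∈T z∈p x∈p (S⊆⁅y⁆ (y≢z ∘ sym)) (S⊆⁅y⁆ x≢y)
      x∈C⇒z∈C : x ∈ C → z ∈ C
      x∈C⇒z∈C = closed t∈T x∈p z∈p (S⊆⁅y⁆ x≢y) (S⊆⁅y⁆ (y≢z ∘ sym))
      absurd : Empty D ⊎ W′ ⊆ D → ⊥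
      absurd (inj₁ D≡∅) with c , c∈C ← Odd∣p∣⇒Nonempty odd with c ≟ᶠ z
      ... | no  c≢z  = D≡∅ (c , x∈p∧x≢y⇒x∈p-y c∈C c≢z)
      ... | yes refl = D≡∅ (x , x∈p∧x≢y⇒x∈p-y (z∈C⇒x∈C c∈C) x≢z)
      absurd (inj₂ W′⊆D) = Odd⇒¬Odd-suc {∣ W′ ∣} W′-odd (subst Odd ∣C∣≡1+∣W′∣ odd)
        where
        ∣C∣≡1+∣W′∣ : ∣ C ∣ ≡ suc ∣ W′ ∣
        ∣C∣≡1+∣W′∣ = trans (∣p∣≡1+∣p-x∣ (x∈C⇒z∈C (x∈p-y⇒x∈p C (W′⊆D (x∈p-y-z⁺ x∈W x≢y x≢z)))))
                           (cong (suc ∘ ∣_∣) (⊆-antisym D⊆W′ W′⊆D))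

    piece∋x : ∀ {S C} → y ∈ S → z ∈ S → (∀ {u} → u ≢ y → u ≢ z → u ∉ S) → OddPiece T S W C → x ∈ C
    piece∋x y∈S z∈S S⊆yz piece
      with connects′ (OddPiece.⊆W piece′) (OddPiece.closed piece′)
      where
      piece′ = piece-⊆W′ piece (λ y∈C → OddPiece.avoids piece y∈C y∈S)
                               (λ z∈C → OddPiece.avoids piece z∈C z∈S) (⊥-elim ∘ ∉⊥) (λ _ → S⊆yz)
    ... | inj₁ C≡∅  = contradiction (Odd∣p∣⇒Nonempty (OddPiece.odd piece)) C≡∅
    ... | inj₂ W′⊆C = W′⊆C (x∈p-y-z⁺ x∈W x≢y x≢z)

    bound-y∉S-z∉S : OddPieceBound T′ W′ →
                    ∀ {S} → y ∉ S → z ∉ S → Nonempty S → S ⊆ W → FewOddPieces T S W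
    bound-y∉S-z∉S ih {S} y∉S z∉S S≢∅ S⊆W {Cs} disjoint pieces =
      subst (_≤ ∣ S ∣ ∸ 1) (length-map (λ C → C - y - z) Cs)
        (ih S≢∅ (λ v∈S → x∈p-y-z⁺ (S⊆W v∈S) (λ { refl → y∉S v∈S }) (λ { refl → z∉S v∈S }))
            (AllPairs.map⁺ (AllPairs.map shrink disjoint))
            (All.map⁺ (All.map (piece-y-z y∉S z∉S) pieces)))
      where
      shrink : ∀ {C D} → Disjoint C D → Disjoint (C - y - z) (D - y - z)
      shrink {C} {D} C∩D≡∅ u∈C′ u∈D′ = C∩D≡∅ (proj₁ (x∈p-y-z⁻ C u∈C′)) (proj₁ (x∈p-y-z⁻ D u∈D′))

    -- At most one piece meets z; the others are pieces for T′ and S − y.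
    bound-y∈S-z∉S : Odd ∣ W′ ∣ → OddPieceBound T′ W′ →
                    ∀ {S} → y ∈ S → z ∉ S → S ⊆ W → FewOddPieces T S W
    bound-y∈S-z∉S W′-odd ih {S} y∈S z∉S S⊆W {Cs} disjoint pieces with nonempty? (S - y)
    ... | no S-y≡∅ = length≤-uninhabited
      (no-piece-at-y W′-odd y∈S λ u≢y u∈S → S-y≡∅ (_ , x∈p∧x≢y⇒x∈p-y u∈S u≢y)) pieces
    ... | yes (s , s∈S-y) = begin
      length Cs            ≤⟨ length≤1+filter-∉ z disjoint ⟩
      suc (length Cs′)     ≤⟨ s≤s (ih (s , s∈S-y) S-y⊆W′ (AllPairs.filter⁺ z∉? disjoint) pieces′) ⟩
      suc (∣ S - y ∣ ∸ 1)  ≡⟨ cong (λ k → suc (k ∸ 1)) (∣p∣≡1+∣p-x∣ s∈S-y) ⟩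
      suc ∣ S - y - s ∣    ≡⟨ ∣p∣≡1+∣p-x∣ s∈S-y ⟨
      ∣ S - y ∣            ≡⟨ cong (_∸ 1) (∣p∣≡1+∣p-x∣ y∈S) ⟨
      ∣ S ∣ ∸ 1            ∎
      where
      open ≤-Reasoning
      z∉? : ∀ C → Dec (z ∉ C)
      z∉? C = ¬? (z ∈? C)
      Cs′ = filter z∉? Cs
      S-y⊆W′ : S - y ⊆ W′
      S-y⊆W′ v∈S-y = let v∈S = x∈p-y⇒x∈p S v∈S-y in
        x∈p-y-z⁺ (S⊆W v∈S) (x∈p-y⇒x≢y S v∈S-y) (λ { refl → z∉S v∈S })
      pieces′ : All (OddPiece T′ (S - y) W′) Cs′
      pieces′ = All.map
        (λ (piece , z∉C) → piece-⊆W′ piece (λ y∈C → OddPiece.avoids piece y∈C y∈S) z∉C (x∈p-y⇒x∈p S)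
                             (λ u∉S-y u≢y _ u∈S → u∉S-y (x∈p∧x≢y⇒x∈p-y u∈S u≢y)))
        (All.zip (All.filter⁺ z∉? pieces , All.all-filter z∉? Cs))

    -- If S ⊆ {y, z} then every piece contains x, so there is at most one.
    bound-y∈S-z∈S : OddPieceBound T′ W′ → ∀ {S} → y ∈ S → z ∈ S → S ⊆ W → FewOddPieces T S W
    bound-y∈S-z∈S ih {S} y∈S z∈S S⊆W {Cs} disjoint pieces =
      subst (length Cs ≤_) (cong (_∸ 1) (sym (∣p∣≡2+∣p-x-y∣ y∈S z∈S y≢z))) bound
      where
      S′ = S - y - z
      bound : length Cs ≤ suc ∣ S′ ∣
      bound with nonempty? S′
      ... | yes S′≢∅ =
        ≤-trans (ih S′≢∅ S′⊆W′ disjoint (All.map piece′ pieces)) (≤-trans (m∸n≤m _ 1) (n≤1+n _))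
        where
        S′⊆W′ : S′ ⊆ W′
        S′⊆W′ v∈S′ = let v∈S , v≢y , v≢z = x∈p-y-z⁻ S v∈S′ in x∈p-y-z⁺ (S⊆W v∈S) v≢y v≢z
        piece′ : ∀ {C} → OddPiece T S W C → OddPiece T′ S′ W′ C
        piece′ piece = piece-⊆W′ piece (λ y∈C → OddPiece.avoids piece y∈C y∈S)
          (λ z∈C → OddPiece.avoids piece z∈C z∈S) (proj₁ ∘ x∈p-y-z⁻ S)
          (λ u∉S′ u≢y u≢z u∈S → u∉S′ (x∈p-y-z⁺ u∈S u≢y u≢z))
      ... | no S′≡∅ = ≤-trans (length≤1 disjoint (All.map (piece∋x y∈S z∈S S⊆yz) pieces)) (s≤s z≤n)
        where
        S⊆yz : ∀ {u} → u ≢ y → u ≢ z → u ∉ S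
        S⊆yz u≢y u≢z u∈S = S′≡∅ (_ , x∈p-y-z⁺ u∈S u≢y u≢z)

  prune-bound : ∀ {T W} (tree : TreeOn T W) (leaf : Leaf H T) → let open Prune tree leaf in
                Odd ∣ W′ ∣ → OddPieceBound T′ W′ → OddPieceBound T W
  prune-bound {T} {W} tree leaf W′-odd ih {S} S≢∅ S⊆W with y ∈? S | z ∈? S
    where open Leaf leaf
  ... | no  y∉S | no  z∉S = Prune.bound-y∉S-z∉S tree leaf ih y∉S z∉S S≢∅ S⊆W
  ... | yes y∈S | no  z∉S = Prune.bound-y∈S-z∉S tree leaf W′-odd ih y∈S z∉S S⊆W
  ... | yes y∈S | yes z∈S = Prune.bound-y∈S-z∈S tree leaf ih y∈S z∈S S⊆W
  -- The leaf with y and z exchanged prunes to W − z − y.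
  ... | no  y∉S | yes z∈S = Prune.bound-y∈S-z∉S tree (Leaf.swap leaf)
    (subst (Odd ∘ ∣_∣) W-y-z≡W-z-y W′-odd) (subst (OddPieceBound (T - t)) W-y-z≡W-z-y ih) z∈S y∉S S⊆W
    where
    open Leaf leaf
    W-y-z≡W-z-y : W - y - z ≡ W - z - y
    W-y-z≡W-z-y = p─x─y≡p─y─x W y z

  tree⇒odd×bound : ∀ k {T W} → ∣ T ∣ ≡ k → TreeOn T W → Odd ∣ W ∣ × OddPieceBound T W
  tree⇒odd×bound zero    ∣T∣≡0   tree = no-triples (λ i∈T → x∈p⇒∣p∣≢0 i∈T ∣T∣≡0) tree
  tree⇒odd×bound (suc k) {T} {W} ∣T∣≡1+k tree =
    prune (leaf-exists (TreeOn.acyclic tree)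
                       (∣p∣≢0⇒Nonempty λ ∣T∣≡0 → 0≢1+n (trans (sym ∣T∣≡0) ∣T∣≡1+k)))
    where
    prune : Leaf H T → Odd ∣ W ∣ × OddPieceBound T W
    prune leaf = subst Odd (sym ∣W∣≡2+∣W′∣) W′-odd , prune-bound tree leaf W′-odd ih
      where
      open Prune tree leaf
      W′-odd×ih : Odd ∣ W′ ∣ × OddPieceBound T′ W′
      W′-odd×ih = tree⇒odd×bound k (∣p-x∣≡k (Leaf.t∈T leaf) ∣T∣≡1+k) tree′
      W′-odd = proj₁ W′-odd×ih
      ih = proj₂ W′-odd×ih

module Components {n m : ℕ} (H : ThreeGraph n m) where

  open OddPieces H

  Reach⇒∈ : ∀ {S C u v} → IsComponent H S C → Reach H S u v → u ∈ C → v ∈ C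
  Reach⇒∈ component (here _) u∈C = u∈C
  Reach⇒∈ component (step _ u~w w⇝v) u∈C =
    Reach⇒∈ component w⇝v (IsComponent.maximal component _ _ u∈C (source∉S w⇝v) u~w)
    where
    source∉S : ∀ {S u v} → Reach H S u v → u ∉ S
    source∉S (here u∉S)     = u∉S
    source∉S (step u∉S _ _) = u∉S

  component-⊆ : ∀ {S C D u} → IsComponent H S C → IsComponent H S D → u ∈ C → u ∈ D → C ⊆ D
  component-⊆ C-comp D-comp u∈C u∈D v∈C = Reach⇒∈ D-comp (IsComponent.conn C-comp _ _ u∈C v∈C) u∈D

  odd-components-disjoint : ∀ {S Cs} → Unique Cs → All (IsOddComponent H S) Cs → AllPairs Disjoint Cs
  odd-components-disjoint []               []                = []
  odd-components-disjoint (C≢Ds ∷ unique) ((C-comp , _) ∷ comps) =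
    All.zipWith disjoint (C≢Ds , comps) ∷ odd-components-disjoint unique comps
    where
    disjoint : ∀ {D} → _ × IsOddComponent H _ D → Disjoint _ D
    disjoint (C≢D , D-comp , _) u∈C u∈D =
      C≢D (⊆-antisym (component-⊆ C-comp D-comp u∈C u∈D) (component-⊆ D-comp C-comp u∈D u∈C))

  odd-component⇒piece : ∀ {T S C} → IsOddComponent H S C → OddPiece T S ⊤ C
  odd-component⇒piece {T} {S} {C} (component , odd) = record
    { odd = odd ; ⊆W = λ _ → ∈⊤ ; avoids = IsComponent.avoids component _ ; closed = closed }
    where
    closed : Closed T S C
    closed {i = i} _ {u} {w} u∈i w∈i _ w∉S u∈C with u ≟ᶠ w
    ... | yes refl = u∈C
    ... | no  u≢w  = IsComponent.maximal component u w u∈C w∉S (u≢w , i , u∈i , w∈i)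

  path⇒∈ : ∀ {T C u v} → PathIn H T u v → Closed T ∅ C → u ∈ C → v ∈ C
  path⇒∈ {C = C} path closed u∈C =
    subst (_∈ C) end (<-weakInduction (λ i → a i ∈ C) (subst (_∈ C) (sym start) u∈C)
      (λ i ai∈C → closed (t∈T i) (left∈ i) (right∈ i) ∉⊥ ∉⊥ ai∈C) (fromℕ (PathIn.k path)))
    where open PathIn path

  spanning⇒TreeOn : ∀ {T} → SpanningTree H T → Nonempty (⊤ {n}) → TreeOn T ⊤
  spanning⇒TreeOn {T} tree V≢∅ = record
    { acyclic  = SpanningTree.acyclic tree
    ; spans⊆   = λ _ _ → ∈⊤
    ; nonempty = V≢∅
    ; connects = connects }
    where
    connects : Connects T ⊤
    connects {C} _ closed with nonempty? C
    ... | no  C≡∅      = inj₁ C≡∅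
    ... | yes (c , c∈C) = inj₂ λ {v} _ → path⇒∈ (SpanningTree.connected tree c v) closed c∈C

theorem3p5 : ∀ {n m : ℕ} (H : ThreeGraph n m) → HasSpanningTree H →
    ∀ (S : Subset n) → Nonempty S → q≤ H S (∣ S ∣ ∸ 1)
theorem3p5 H (T , tree) S S≢∅@(s , _) Cs unique odd-components =
  proj₂ (tree⇒odd×bound ∣ T ∣ refl (spanning⇒TreeOn tree (s , ∈⊤)))
    S≢∅ (λ _ → ∈⊤) (odd-components-disjoint unique odd-components)
    (All.map odd-component⇒piece odd-components)
  where
  open OddPieces H
  open Components H
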